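{- Let $G$ be a map on an orientable surface. An oriented subgraph $T$ of $G$ is partitionable if and only if it is a topological Tutte-orientation.
   Context: A map is a graph embedded on an orientable surface with all faces open disks and no contractible cycles of length 1 or 2. Fix a reference orientation of $G$; an oriented subgraph (set of edges each with a direction) or walk has a characteristic flow $\phi\in\mathbb{Z}^{E}$ (per traversal, $+1$ along the reference orientation, $-1$ against). Let $\mathbb{F}$ be the subgroup of $\mathbb{Z}^E$ generated by characteristic flows of counterclockwise facial walks. $T$ is partitionable if its edge set can be partitioned into $T_0,T_1,T_2$ with $\phi(T_i)-\phi(T_j)\in\mathbb{F}$ for all $i,j$. Orient each dual edge $e^*$ from the face on the right of $e$ to the face on the left of $e$, and for a flow $p$ of $G$ and a flow $d$ of $G^*$ let $\beta(p,d)=\sum_{e}p_e d_{e^*}$ (for a walk $W$ of $G^*$, $\beta(T,W)$ is the number of edges of $T$ crossing $W$ from left to right minus the number crossing from right to left). $T$ is a topological Tutte-orientation if $\beta(T,W)\equiv 0\pmod 3$ for every closed walk $W$ of $G^*$. -}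

module Defs where

open import Data.Nat using (ℕ; zero; suc)
open import Data.Fin using (Fin; zero; suc; _≟_)
open import Data.Bool using (Bool; true; false; not; if_then_else_)
open import Data.Product using (Σ; ∃; _×_; _,_; proj₁; proj₂)
open import Data.Sum using (_⊎_)
open import Data.Maybe using (Maybe; just; nothing)
open import Data.Integer using (ℤ; +_; -_; _+_; _-_; _*_)
open import Data.List using (List; []; _∷_; _++_; map; foldr)
open import Data.List.Relation.Unary.All using (All)
open import Data.List.Relation.Unary.Unique.Propositional using (Unique)
open import Relation.Binary.PropositionalEquality using (_≡_; _≢_)
open import Relation.Binary.Construct.Closure.Equivalence using (EqClosure)
open import Relation.Nullary using (¬_; does)
open import Data.Unit using (⊤)
open import Data.Empty using (⊥)
open import Data.Integer.Divisibility using (_∣_)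

-- The dart (e , true) traverses e along its reference
-- orientation, (e , false) against it.  A map is given by a rotation
-- permutation σ of the darts (σ d = next dart around the tail vertex of d,
-- in the rotational sense for which φ below traces faces keeping the face
-- on the LEFT, i.e. counterclockwise facial walks).  Vertices are the
-- σ-orbits, faces are the φ-orbits with φ d = σ (rev d).  Every face of a
-- combinatorial map is an open disk (cellular embedding), and the
-- orientable surface is the one obtained by gluing these disks.

Dart : ℕ → Set
Dart m = Fin m × Bool

rev : ∀ {m} → Dart m → Dart m
rev (e , b) = (e , not b)

iter : ∀ {A : Set} → (A → A) → ℕ → A → A
iter f zero    x = x
iter f (suc k) x = f (iter f k x)

record Map (m : ℕ) : Set where
  field
    σ   : Dart m → Dart m
    σ⁻  : Dart m → Dart m
    σσ⁻ : ∀ d → σ (σ⁻ d) ≡ d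
    σ⁻σ : ∀ d → σ⁻ (σ d) ≡ d

module _ {m : ℕ} (G : Map m) where
  open Map G

  φ : Dart m → Dart m
  φ d = σ (rev d)

  SameVertex : Dart m → Dart m → Set
  SameVertex d d' = ∃ λ k → iter σ k d ≡ d'

  SameFace : Dart m → Dart m → Set
  SameFace d d' = ∃ λ k → iter φ k d ≡ d'

  data Reach : Dart m → Dart m → Set where
    here  : ∀ {d} → Reach d d
    viaσ  : ∀ {d d'} → Reach (σ d) d' → Reach d d'
    viarev : ∀ {d d'} → Reach (rev d) d' → Reach d d'

  Connected : Set
  Connected = ∀ d d' → Reach d d'

  Consecutive : List (Dart m) → Set
  Consecutive []            = ⊤
  Consecutive (d ∷ [])      = ⊤
  Consecutive (d ∷ d' ∷ w)  = SameVertex (rev d) d' × Consecutive (d' ∷ w)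

  lastHeadAt : Dart m → List (Dart m) → Set
  lastHeadAt v []           = ⊤
  lastHeadAt v (d ∷ [])     = SameVertex (rev d) v
  lastHeadAt v (d ∷ d' ∷ w) = lastHeadAt v (d' ∷ w)

  -- closed walk based at the tail vertex of the dart v (empty walk allowed)
  ClosedWalkAt : Dart m → List (Dart m) → Set
  ClosedWalkAt v []      = ⊤
  ClosedWalkAt v (d ∷ w) = SameVertex v d × Consecutive (d ∷ w) × lastHeadAt v (d ∷ w)

  φChain : List (Dart m) → Set
  φChain []           = ⊤
  φChain (d ∷ [])     = ⊤
  φChain (d ∷ d' ∷ w) = φ d ≡ d' × φChain (d' ∷ w)

  lastφTo : Dart m → List (Dart m) → Set
  lastφTo v []           = ⊥
  lastφTo v (d ∷ [])     = φ d ≡ v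
  lastφTo v (d ∷ d' ∷ w) = lastφTo v (d' ∷ w)

  IsFacialWalk : List (Dart m) → Set
  IsFacialWalk []      = ⊥
  IsFacialWalk (d ∷ w) = φChain (d ∷ w) × lastφTo d (d ∷ w) × Unique (d ∷ w)

  Move : Dart m → List (Dart m) → List (Dart m) → Set
  Move v L L' = ClosedWalkAt v L × ClosedWalkAt v L' ×
    (∃ λ A → ∃ λ B → ∃ λ X → L ≡ A ++ B × L' ≡ A ++ X ++ B ×
       ((∃ λ d → X ≡ d ∷ rev d ∷ []) ⊎ IsFacialWalk X))

  -- a closed walk is contractible if it is combinatorially homotopic
  -- (in the 2-complex of the map, i.e. the surface) to the trivial walk
  Contractible : List (Dart m) → Set
  Contractible L = ∃ λ v → EqClosure (Move v) L []

  NoShortContractibleCycles : Set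
  NoShortContractibleCycles =
    (∀ d → SameVertex (rev d) d → ¬ Contractible (d ∷ [])) ×
    (∀ d₁ d₂ → SameVertex (rev d₁) d₂ → SameVertex (rev d₂) d₁ →
       proj₁ d₁ ≢ proj₁ d₂ → ¬ SameVertex d₁ d₂ →
       ¬ Contractible (d₁ ∷ d₂ ∷ []))

Flow : ℕ → Set
Flow m = Fin m → ℤ

sumFin : ∀ {n} → (Fin n → ℤ) → ℤ
sumFin {zero}  f = + 0
sumFin {suc n} f = f zero + sumFin (λ i → f (suc i))

dartFlow : ∀ {m} → Dart m → Flow m
dartFlow (e , b) e' = if does (e ≟ e') then (if b then + 1 else - (+ 1)) else + 0

-- characteristic flow of a walk (in G, or in G* using Dart m for dual darts)
walkFlow : ∀ {m} → List (Dart m) → Flow m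
walkFlow []      e = + 0
walkFlow (d ∷ w) e = dartFlow d e + walkFlow w e

OrientedSubgraph : ℕ → Set
OrientedSubgraph m = Fin m → Maybe Bool

subFlow : ∀ {m} → OrientedSubgraph m → Flow m
subFlow T e with T e
... | nothing    = + 0
... | just true  = + 1
... | just false = - (+ 1)

In𝔽 : ∀ {m} → Map m → Flow m → Set
In𝔽 {m} G x = ∃ λ (gs : List (ℤ × List (Dart m))) →
  All (λ g → IsFacialWalk G (proj₂ g)) gs ×
  (∀ e → x e ≡ foldr _+_ (+ 0) (map (λ g → proj₁ g * walkFlow (proj₂ g) e) gs))

part : ∀ {m} → OrientedSubgraph m → (Fin m → Fin 3) → Fin 3 → OrientedSubgraph m
part T c i e = if does (c e ≟ i) then T e else nothing

Partitionable : ∀ {m} → Map m → OrientedSubgraph m → Set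
Partitionable {m} G T = ∃ λ (c : Fin m → Fin 3) → ∀ i j →
  In𝔽 G (λ e → subFlow (part T c i) e - subFlow (part T c j) e)

-- A dual dart is written (e , b) : Dart m; it traverses e* from the
-- face on the right of the dart (e , b) to the face on its left.  Thus
-- (e , true) goes along the reference orientation of e* (right of e to
-- left of e), and its flow is +1 as given by dartFlow.
-- Face on the left of dart d = φ-orbit of d; on the right = φ-orbit of rev d.

module _ {m : ℕ} (G : Map m) where

  DualConsecutive : List (Dart m) → Set
  DualConsecutive []           = ⊤
  DualConsecutive (δ ∷ [])     = ⊤
  DualConsecutive (δ ∷ δ' ∷ w) = SameFace G δ (rev δ') × DualConsecutive (δ' ∷ w)

  dualLastTo : Dart m → List (Dart m) → Set
  dualLastTo v []           = ⊤
  dualLastTo v (δ ∷ [])     = SameFace G δ (rev v)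
  dualLastTo v (δ ∷ δ' ∷ w) = dualLastTo v (δ' ∷ w)

  IsDualClosedWalk : List (Dart m) → Set
  IsDualClosedWalk []      = ⊤
  IsDualClosedWalk (δ ∷ w) = DualConsecutive (δ ∷ w) × dualLastTo δ (δ ∷ w)

β : ∀ {m} → Flow m → Flow m → ℤ
β p d = sumFin (λ e → p e * d e)

TopologicalTutte : ∀ {m} → Map m → OrientedSubgraph m → Set
TopologicalTutte {m} G T = ∀ (W : List (Dart m)) → IsDualClosedWalk G W →
  (+ 3) ∣ β (subFlow T) (walkFlow W)

-- Both directions rest on the pairing β of flows of G with walks of the dual
-- G*, computed here as the crossing sum  cross p W.
--
-- (⇒) A facial walk X and a closed dual walk W are orthogonal: the number of
--     times X uses a dart only depends on the face of that dart, so the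
--     crossings of X along W telescope to 0 (flux-closed).  Hence every flow
--     in 𝔽 is orthogonal to W, the three classes T₀, T₁, T₂ of a partition
--     are crossed equally often, and W crosses T = T₀ + T₁ + T₂ a multiple
--     of 3 times.
-- (⇐) In a connected map, crossing numbers of T along dual paths from a base
--     face define a potential ρ on faces with values in ℤ₃, and T is its
--     coboundary.  Colouring every edge by the lower potential of its two
--     faces, each difference Tᵢ - Tⱼ is the coboundary of a ℤ-valued
--     function of ρ.  Every face coboundary lies in 𝔽: it is the weighted
--     sum of the facial walks, one per face, where the faces are enumerated
--     as orbits of φ (with least-code representatives).

module Submission where

open import Defs
open import Data.Nat using (ℕ)
open import Data.Product using (_×_)
open import Function.Bundles using (_⇔_; mk⇔)

open import Data.Nat as ℕ using (zero; suc)
import Data.Nat.Properties as ℕₚ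
open import Data.Fin as Fin using (Fin; zero; suc; _≟_)
import Data.Fin.Properties as Finₚ
open import Data.Bool as Bool using (Bool; true; false; not; if_then_else_)
import Data.Bool.Properties as Boolₚ
open import Data.Product using (∃; _,_; proj₁; proj₂)
open import Data.Sum using (_⊎_; inj₁; inj₂)
open import Data.Maybe using (Maybe; just; nothing)
open import Data.Integer as ℤ using (ℤ; +_; -_; _+_; _-_; _*_)
import Data.Integer.Properties as ℤ
import Data.Integer.Divisibility.Signed as S
open import Data.Integer.DivMod using (_%ℕ_; _/ℕ_; n%ℕd<d; a≡a%ℕn+[a/ℕn]*n)
open import Data.Integer.Tactic.RingSolver using (solve-∀)
open import Data.List using (List; []; _∷_; _++_; [_]; map; foldr; iterate; tabulate)
open import Data.List.Properties using (tabulate-cong)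
open import Data.List.Relation.Unary.Unique.Propositional using (Unique)
open import Data.List.Relation.Unary.AllPairs using (_∷_)
import Data.List.Relation.Unary.Unique.Propositional.Properties as Uniqueₚ
open import Data.List.Membership.Propositional using (_∈_)
import Data.List.Membership.Propositional.Properties as ∈ₚ
open import Data.List.Relation.Unary.Any using (here; there)
import Data.Nat.DivMod as DivMod
open import Data.List.Relation.Unary.All as All using (All; []; _∷_)
import Data.List.Relation.Unary.All.Properties as Allₚ
open import Relation.Binary.PropositionalEquality hiding ([_])
open import Relation.Binary.Definitions using (DecidableEquality; tri<; tri≈; tri>)
open import Relation.Nullary using (¬_; Dec; does; yes; no; contradiction)
open import Relation.Nullary.Decidable using (toWitness; toWitnessFalse)
open import Data.Unit using (tt)
open import Data.Product.Properties using (≡-dec)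

+-−-interchange : ∀ a b c d → (a - b) + (c - d) ≡ (a + c) - (b + d)
+-−-interchange = solve-∀

sumFin-cong : ∀ {n} {f g : Fin n → ℤ} → (∀ i → f i ≡ g i) → sumFin f ≡ sumFin g
sumFin-cong {zero}  f≗g = refl
sumFin-cong {suc n} f≗g = cong₂ _+_ (f≗g zero) (sumFin-cong (λ i → f≗g (suc i)))

sumFin-+ : ∀ {n} (f g : Fin n → ℤ) → sumFin (λ i → f i + g i) ≡ sumFin f + sumFin g
sumFin-+ {zero}  f g = refl
sumFin-+ {suc n} f g = trans (cong (_+_ (f zero + g zero)) (sumFin-+ (λ i → f (suc i)) (λ i → g (suc i))))
                             (interchange (f zero) (g zero) _ _)
  where
    interchange : ∀ a b c d → (a + b) + (c + d) ≡ (a + c) + (b + d)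
    interchange = solve-∀

sumFin-− : ∀ {n} (f g : Fin n → ℤ) → sumFin (λ i → f i - g i) ≡ sumFin f - sumFin g
sumFin-− {zero}  f g = refl
sumFin-− {suc n} f g = trans (cong (_+_ (f zero - g zero)) (sumFin-− (λ i → f (suc i)) (λ i → g (suc i))))
                             (+-−-interchange (f zero) (g zero) _ _)

sumFin-zero : ∀ n → sumFin {n} (λ _ → + 0) ≡ + 0
sumFin-zero zero    = refl
sumFin-zero (suc n) = trans (ℤ.+-identityˡ _) (sumFin-zero n)

sumFin-delta : ∀ {n} (i : Fin n) (f : Fin n → ℤ) → sumFin (λ j → if does (i ≟ j) then f j else + 0) ≡ f i
sumFin-delta {suc n} zero    f = trans (cong (_+_ (f zero)) (sumFin-zero n)) (ℤ.+-identityʳ (f zero))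
sumFin-delta {suc n} (suc i) f = trans (ℤ.+-identityˡ _) (sumFin-delta i (λ j → f (suc j)))

sgn : Bool → ℤ
sgn b = if b then + 1 else - (+ 1)

sign : Maybe Bool → ℤ
sign nothing      = + 0
sign (just true)  = + 1
sign (just false) = - (+ 1)

subFlow-sign : ∀ {m} (T : OrientedSubgraph m) e → subFlow T e ≡ sign (T e)
subFlow-sign T e with T e
... | nothing    = refl
... | just true  = refl
... | just false = refl

cross : ∀ {m} → Flow m → List (Dart m) → ℤ
cross p []            = + 0
cross p ((e , b) ∷ W) = p e * sgn b + cross p W

β-walkFlow : ∀ {m} (p : Flow m) (W : List (Dart m)) → β p (walkFlow W) ≡ cross p W
β-walkFlow {m} p [] = trans (sumFin-cong (λ e → ℤ.*-zeroʳ (p e))) (sumFin-zero m)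
β-walkFlow p ((e , b) ∷ W) = begin
  sumFin (λ e′ → p e′ * (dartFlow (e , b) e′ + walkFlow W e′))
    ≡⟨ sumFin-cong (λ e′ → ℤ.*-distribˡ-+ (p e′) _ _) ⟩
  sumFin (λ e′ → p e′ * dartFlow (e , b) e′ + p e′ * walkFlow W e′)
    ≡⟨ sumFin-+ (λ e′ → p e′ * dartFlow (e , b) e′) (λ e′ → p e′ * walkFlow W e′) ⟩
  sumFin (λ e′ → p e′ * dartFlow (e , b) e′) + β p (walkFlow W)
    ≡⟨ cong₂ _+_ (trans (sumFin-cong meets) (sumFin-delta e (λ e′ → p e′ * sgn b))) (β-walkFlow p W) ⟩
  p e * sgn b + cross p W ∎
  where
    open ≡-Reasoning
    meets : ∀ e′ → p e′ * dartFlow (e , b) e′ ≡ (if does (e ≟ e′) then p e′ * sgn b else + 0)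
    meets e′ with does (e ≟ e′)
    ... | true  = refl
    ... | false = ℤ.*-zeroʳ (p e′)

cross-cong : ∀ {m} {p q : Flow m} (W : List (Dart m)) → (∀ e → p e ≡ q e) → cross p W ≡ cross q W
cross-cong []            p≗q = refl
cross-cong ((e , b) ∷ W) p≗q = cong₂ (λ x y → x * sgn b + y) (p≗q e) (cross-cong W p≗q)

cross-zero : ∀ {m} (W : List (Dart m)) → cross (λ _ → + 0) W ≡ + 0
cross-zero []            = refl
cross-zero ((e , b) ∷ W) = cong₂ _+_ (ℤ.*-zeroˡ (sgn b)) (cross-zero W)

cross-+ : ∀ {m} (p q : Flow m) (W : List (Dart m)) → cross (λ e → p e + q e) W ≡ cross p W + cross q W
cross-+ p q []            = refl
cross-+ p q ((e , b) ∷ W) = trans (cong (_+_ ((p e + q e) * sgn b)) (cross-+ p q W)) (expand (p e) (q e) _ _ (sgn b))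
  where
    expand : ∀ x y u v s → (x + y) * s + (u + v) ≡ (x * s + u) + (y * s + v)
    expand = solve-∀

cross-− : ∀ {m} (p q : Flow m) (W : List (Dart m)) → cross (λ e → p e - q e) W ≡ cross p W - cross q W
cross-− p q []            = refl
cross-− p q ((e , b) ∷ W) = trans (cong (_+_ ((p e - q e) * sgn b)) (cross-− p q W)) (expand (p e) (q e) _ _ (sgn b))
  where
    expand : ∀ x y u v s → (x - y) * s + (u - v) ≡ (x * s + u) - (y * s + v)
    expand = solve-∀

cross-scale : ∀ {m} (k : ℤ) (p : Flow m) (W : List (Dart m)) → cross (λ e → k * p e) W ≡ k * cross p W
cross-scale k p []            = sym (ℤ.*-zeroʳ k)
cross-scale k p ((e , b) ∷ W) = trans (cong (_+_ ((k * p e) * sgn b)) (cross-scale k p W)) (factor k (p e) (sgn b) _)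
  where
    factor : ∀ k x s u → (k * x) * s + k * u ≡ k * (x * s + u)
    factor = solve-∀

cross-++ : ∀ {m} (p : Flow m) (W W′ : List (Dart m)) → cross p (W ++ W′) ≡ cross p W + cross p W′
cross-++ p []            W′ = sym (ℤ.+-identityˡ _)
cross-++ p ((e , b) ∷ W) W′ = trans (cong (_+_ (p e * sgn b)) (cross-++ p W W′)) (sym (ℤ.+-assoc (p e * sgn b) _ _))

_≟ᵈ_ : ∀ {m} → DecidableEquality (Dart m)
_≟ᵈ_ = ≡-dec _≟_ Bool._≟_

hit : ∀ {m} → Dart m → Dart m → ℤ
hit x y = if does (x ≟ᵈ y) then + 1 else + 0

occ : ∀ {m} → Dart m → List (Dart m) → ℤ
occ y []      = + 0
occ y (x ∷ X) = hit x y + occ y X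

walkFlow-occ : ∀ {m} (X : List (Dart m)) e b → walkFlow X e * sgn b ≡ occ (e , b) X - occ (rev (e , b)) X
walkFlow-occ []      e b = refl
walkFlow-occ (x ∷ X) e b = begin
  (dartFlow x e + walkFlow X e) * sgn b     ≡⟨ ℤ.*-distribʳ-+ (sgn b) (dartFlow x e) (walkFlow X e) ⟩
  dartFlow x e * sgn b + walkFlow X e * sgn b ≡⟨ cong₂ _+_ (dart x) (walkFlow-occ X e b) ⟩
  (hit x (e , b) - hit x (e , not b)) + (occ (e , b) X - occ (e , not b) X)
    ≡⟨ +-−-interchange (hit x (e , b)) (hit x (e , not b)) (occ (e , b) X) (occ (e , not b) X) ⟩
  occ (e , b) (x ∷ X) - occ (e , not b) (x ∷ X) ∎
  where
    open ≡-Reasoning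
    dart : ∀ x {e} {b} → dartFlow x e * sgn b ≡ hit x (e , b) - hit x (e , not b)
    dart (e′ , b′) {e} with e′ ≟ e
    dart (e′ , true)  {b = true}  | yes refl = refl
    dart (e′ , true)  {b = false} | yes refl = refl
    dart (e′ , false) {b = true}  | yes refl = refl
    dart (e′ , false) {b = false} | yes refl = refl
    dart (e′ , b′)                | no _ = refl

hit-refl : ∀ {m} (x : Dart m) → hit x x ≡ + 1
hit-refl x with x ≟ᵈ x
... | yes _   = refl
... | no x≢x = contradiction refl x≢x

hit-≢ : ∀ {m} {x y : Dart m} → x ≢ y → hit x y ≡ + 0
hit-≢ {x = x} {y} x≢y with x ≟ᵈ y
... | yes x≡y = contradiction x≡y x≢y
... | no _    = refl

occ-++ : ∀ {m} (y : Dart m) X Y → occ y (X ++ Y) ≡ occ y X + occ y Y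
occ-++ y []      Y = sym (ℤ.+-identityˡ _)
occ-++ y (x ∷ X) Y = trans (cong (_+_ (hit x y)) (occ-++ y X Y)) (sym (ℤ.+-assoc (hit x y) _ _))

occ-map : ∀ {m} (f : Dart m → Dart m) → (∀ {x y} → f x ≡ f y → x ≡ y) →
          ∀ y X → occ (f y) (map f X) ≡ occ y X
occ-map f f-inj y []      = refl
occ-map f f-inj y (x ∷ X) = cong₂ _+_ hit-f (occ-map f f-inj y X)
  where
    hit-f : hit (f x) (f y) ≡ hit x y
    hit-f with x ≟ᵈ y
    ... | yes refl = hit-refl (f x)
    ... | no x≢y   = hit-≢ (λ fx≡fy → x≢y (f-inj fx≡fy))

occ-rotate : ∀ {m} (y d : Dart m) w → occ y (w ++ [ d ]) ≡ occ y (d ∷ w)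
occ-rotate y d w = begin
  occ y (w ++ [ d ])       ≡⟨ occ-++ y w [ d ] ⟩
  occ y w + (hit d y + + 0) ≡⟨ cong (_+_ (occ y w)) (ℤ.+-identityʳ (hit d y)) ⟩
  occ y w + hit d y        ≡⟨ ℤ.+-comm (occ y w) (hit d y) ⟩
  hit d y + occ y w        ∎
  where open ≡-Reasoning

rev-involutive : ∀ {m} (d : Dart m) → rev (rev d) ≡ d
rev-involutive (e , b) = cong (e ,_) (Boolₚ.not-involutive b)

occ-∉ : ∀ {m} {y : Dart m} {X} → ¬ y ∈ X → occ y X ≡ + 0
occ-∉ {X = []}    y∉X = refl
occ-∉ {X = x ∷ X} y∉X = cong₂ _+_ (hit-≢ (λ x≡y → y∉X (here (sym x≡y)))) (occ-∉ (λ y∈X → y∉X (there y∈X)))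

occ-∈ : ∀ {m} {y : Dart m} {X} → Unique X → y ∈ X → occ y X ≡ + 1
occ-∈ {y = y} {y ∷ X} (y∉X ∷ _) (here refl) =
  cong₂ _+_ (hit-refl y) (occ-∉ {y = y} {X} (λ y∈X → All.lookup y∉X y∈X refl))
occ-∈ {y = y} {x ∷ X} (x∉X ∷ uniq) (there y∈X) =
  trans (cong₂ _+_ (hit-≢ {x = x} {y} (λ x≡y → All.lookup x∉X y∈X x≡y)) (occ-∈ uniq y∈X)) (ℤ.+-identityˡ (+ 1))

ΣDart : ∀ {m} → (Dart m → ℤ) → ℤ
ΣDart g = sumFin (λ e → g (e , true) + g (e , false))

ΣDart-cong : ∀ {m} {g h : Dart m → ℤ} → (∀ d → g d ≡ h d) → ΣDart g ≡ ΣDart h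
ΣDart-cong g≗h = sumFin-cong (λ e → cong₂ _+_ (g≗h (e , true)) (g≗h (e , false)))

ΣDart-− : ∀ {m} (g h : Dart m → ℤ) → ΣDart (λ d → g d - h d) ≡ ΣDart g - ΣDart h
ΣDart-− g h = trans (sumFin-cong (λ e → +-−-interchange (g (e , true)) (h (e , true)) (g (e , false)) (h (e , false))))
                    (sumFin-− (λ e → g (e , true) + g (e , false)) (λ e → h (e , true) + h (e , false)))

ΣDart-delta : ∀ {m} (r : Dart m) (g : Dart m → ℤ) → ΣDart (λ d → if does (r ≟ᵈ d) then g d else + 0) ≡ g r
ΣDart-delta (e , b) g = trans (sumFin-cong (same-edge b)) (sumFin-delta e (λ e′ → g (e′ , b)))
  where
    same-edge : ∀ b e′ → (if does ((e , b) ≟ᵈ (e′ , true)) then g (e′ , true) else + 0)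
                       + (if does ((e , b) ≟ᵈ (e′ , false)) then g (e′ , false) else + 0)
                       ≡ (if does (e ≟ e′) then g (e′ , b) else + 0)
    same-edge b e′ with e ≟ e′
    same-edge true  e′ | yes refl = ℤ.+-identityʳ _
    same-edge false e′ | yes refl = ℤ.+-identityˡ _
    same-edge b     e′ | no _     = refl

Reaches : ∀ {A : Set} → (A → A) → A → A → Set
Reaches f x y = ∃ λ k → iter f k x ≡ y

iter-+ : ∀ {A : Set} (f : A → A) a b x → iter f (a ℕ.+ b) x ≡ iter f a (iter f b x)
iter-+ f zero    b x = refl
iter-+ f (suc a) b x = cong f (iter-+ f a b x)

iter-comm : ∀ {A : Set} (f : A → A) k x → iter f k (f x) ≡ f (iter f k x)
iter-comm f zero    x = refl
iter-comm f (suc k) x = cong f (iter-comm f k x)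

reaches-trans : ∀ {A : Set} {f : A → A} {x y z} → Reaches f x y → Reaches f y z → Reaches f x z
reaches-trans {f = f} {x} (k , refl) (l , refl) = l ℕ.+ k , iter-+ f l k x

module _ {m : ℕ} (G : Map m) where
  open Map G

  φ-injective : ∀ {x y} → φ G x ≡ φ G y → x ≡ y
  φ-injective {x} {y} φx≡φy = begin
    x                 ≡⟨ sym (rev-involutive x) ⟩
    rev (rev x)       ≡⟨ cong rev (sym (σ⁻σ (rev x))) ⟩
    rev (σ⁻ (φ G x))  ≡⟨ cong (λ z → rev (σ⁻ z)) φx≡φy ⟩
    rev (σ⁻ (φ G y))  ≡⟨ cong rev (σ⁻σ (rev y)) ⟩
    rev (rev y)       ≡⟨ rev-involutive y ⟩
    y                 ∎
    where open ≡-Reasoning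

  FaceInvariant : ∀ {A : Set} → (Dart m → A) → Set
  FaceInvariant g = ∀ d → g (φ G d) ≡ g d

  sameFace-invariant : ∀ {A : Set} {g : Dart m → A} → FaceInvariant g → ∀ {a b} → SameFace G a b → g a ≡ g b
  sameFace-invariant inv (zero  , refl) = refl
  sameFace-invariant inv (suc k , refl) = trans (sameFace-invariant inv (k , refl)) (sym (inv _))

  facial-rotation : ∀ {d w} → IsFacialWalk G (d ∷ w) → map (φ G) (d ∷ w) ≡ w ++ [ d ]
  facial-rotation (chain , last , _) = rotate chain last
    where
      rotate : ∀ {v d w} → φChain G (d ∷ w) → lastφTo G v (d ∷ w) → map (φ G) (d ∷ w) ≡ w ++ [ v ]
      rotate {w = []}      _              φd≡v = cong [_] φd≡v
      rotate {w = d′ ∷ w} (φd≡d′ , chain) last = cong₂ _∷_ φd≡d′ (rotate chain last)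

  occ-facial : ∀ {X} → IsFacialWalk G X → FaceInvariant (λ y → occ y X)
  occ-facial {d ∷ w} facial y = begin
    occ (φ G y) (d ∷ w)             ≡⟨ sym (occ-rotate (φ G y) d w) ⟩
    occ (φ G y) (w ++ [ d ])        ≡⟨ cong (occ (φ G y)) (sym (facial-rotation facial)) ⟩
    occ (φ G y) (map (φ G) (d ∷ w)) ≡⟨ occ-map (φ G) φ-injective y (d ∷ w) ⟩
    occ y (d ∷ w)                   ∎
    where open ≡-Reasoning

  flux : (Dart m → ℤ) → List (Dart m) → ℤ
  flux g []      = + 0
  flux g (δ ∷ W) = (g δ - g (rev δ)) + flux g W

  lastDart : Dart m → List (Dart m) → Dart m
  lastDart δ []       = δ
  lastDart δ (δ′ ∷ W) = lastDart δ′ W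

  flux-telescopes : ∀ {g} → FaceInvariant g → ∀ δ W → DualConsecutive G (δ ∷ W) →
                    flux g (δ ∷ W) ≡ g (lastDart δ W) - g (rev δ)
  flux-telescopes {g} inv δ []       _            = ℤ.+-identityʳ _
  flux-telescopes {g} inv δ (δ′ ∷ W) (δ~δ′ , cons) = begin
    (g δ - g (rev δ)) + flux g (δ′ ∷ W)
      ≡⟨ cong₂ (λ x y → (x - g (rev δ)) + y) (sameFace-invariant inv δ~δ′) (flux-telescopes inv δ′ W cons) ⟩
    (g (rev δ′) - g (rev δ)) + (g (lastDart δ′ W) - g (rev δ′))
      ≡⟨ cancel (g (rev δ′)) (g (rev δ)) (g (lastDart δ′ W)) ⟩
    g (lastDart δ′ W) - g (rev δ) ∎
    where
      open ≡-Reasoning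
      cancel : ∀ a b c → (a - b) + (c - a) ≡ c - b
      cancel = solve-∀

  flux-closed : ∀ {g} → FaceInvariant g → ∀ W → IsDualClosedWalk G W → flux g W ≡ + 0
  flux-closed inv []      _             = refl
  flux-closed {g} inv (δ ∷ W) (cons , last) = begin
    flux g (δ ∷ W)                 ≡⟨ flux-telescopes inv δ W cons ⟩
    g (lastDart δ W) - g (rev δ)   ≡⟨ cong (_- g (rev δ)) (sameFace-invariant inv (returns δ W last)) ⟩
    g (rev δ) - g (rev δ)          ≡⟨ ℤ.+-inverseʳ (g (rev δ)) ⟩
    + 0                            ∎
    where
      open ≡-Reasoning
      returns : ∀ {v} δ W → dualLastTo G v (δ ∷ W) → SameFace G (lastDart δ W) (rev v)
      returns δ []       last = last
      returns δ (δ′ ∷ W) last = returns δ′ W last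

  facial⊥dual : ∀ {X} → IsFacialWalk G X → ∀ W → IsDualClosedWalk G W → cross (walkFlow X) W ≡ + 0
  facial⊥dual {X} facial W closed = trans (as-flux W) (flux-closed (occ-facial facial) W closed)
    where
      as-flux : ∀ W → cross (walkFlow X) W ≡ flux (λ y → occ y X) W
      as-flux []            = refl
      as-flux ((e , b) ∷ W) = cong₂ _+_ (walkFlow-occ X e b) (as-flux W)

module _ {m : ℕ} (G : Map m) where

  combination : List (ℤ × List (Dart m)) → Flow m
  combination gs e = foldr _+_ (+ 0) (map (λ g → proj₁ g * walkFlow (proj₂ g) e) gs)

  combination-++ : ∀ gs hs e → combination (gs ++ hs) e ≡ combination gs e + combination hs e
  combination-++ []                 hs e = sym (ℤ.+-identityˡ _)
  combination-++ ((k , X) ∷ gs) hs e =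
    trans (cong (_+_ (k * walkFlow X e)) (combination-++ gs hs e)) (sym (ℤ.+-assoc (k * walkFlow X e) _ _))

  In𝔽-cong : ∀ {x y : Flow m} → (∀ e → x e ≡ y e) → In𝔽 G y → In𝔽 G x
  In𝔽-cong x≗y (gs , facials , y≗) = gs , facials , λ e → trans (x≗y e) (y≗ e)

  In𝔽-zero : In𝔽 G (λ _ → + 0)
  In𝔽-zero = [] , [] , λ _ → refl

  In𝔽-facial : ∀ (k : ℤ) {X} → IsFacialWalk G X → In𝔽 G (λ e → k * walkFlow X e)
  In𝔽-facial k {X} facial = [ (k , X) ] , facial ∷ [] , λ e → sym (ℤ.+-identityʳ _)

  In𝔽-+ : ∀ {x y : Flow m} → In𝔽 G x → In𝔽 G y → In𝔽 G (λ e → x e + y e)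
  In𝔽-+ (gs , gs-facial , x≗) (hs , hs-facial , y≗) =
    gs ++ hs , Allₚ.++⁺ gs-facial hs-facial , λ e → trans (cong₂ _+_ (x≗ e) (y≗ e)) (sym (combination-++ gs hs e))

  In𝔽-sumFin : ∀ {n} (F : Fin n → Flow m) → (∀ i → In𝔽 G (F i)) → In𝔽 G (λ e → sumFin (λ i → F i e))
  In𝔽-sumFin {zero}  F F∈𝔽 = In𝔽-zero
  In𝔽-sumFin {suc n} F F∈𝔽 = In𝔽-+ (F∈𝔽 zero) (In𝔽-sumFin (λ i → F (suc i)) (λ i → F∈𝔽 (suc i)))

  𝔽⊥dual : ∀ {x} → In𝔽 G x → ∀ W → IsDualClosedWalk G W → cross x W ≡ + 0
  𝔽⊥dual (gs , facials , x≗) W closed = trans (cross-cong W x≗) (combination⊥dual gs facials)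
    where
      combination⊥dual : ∀ gs → All (λ g → IsFacialWalk G (proj₂ g)) gs → cross (combination gs) W ≡ + 0
      combination⊥dual []             []                 = cross-zero W
      combination⊥dual ((k , X) ∷ gs) (facial ∷ facials) = begin
        cross (λ e → k * walkFlow X e + combination gs e) W
          ≡⟨ cross-+ (λ e → k * walkFlow X e) (combination gs) W ⟩
        cross (λ e → k * walkFlow X e) W + cross (combination gs) W
          ≡⟨ cong₂ _+_ (cross-scale k (walkFlow X) W) (combination⊥dual gs facials) ⟩
        k * cross (walkFlow X) W + + 0
          ≡⟨ cong (λ z → k * z + + 0) (facial⊥dual G facial W closed) ⟩
        k * + 0 + + 0
          ≡⟨ cong (_+ + 0) (ℤ.*-zeroʳ k) ⟩
        + 0 ∎
        where open ≡-Reasoning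

colour-classes : ∀ (t : Maybe Bool) (c : Fin 3) →
  sign t ≡ sign (if does (c ≟ zero) then t else nothing)
         + (sign (if does (c ≟ suc zero) then t else nothing)
         + sign (if does (c ≟ suc (suc zero)) then t else nothing))
colour-classes t zero             = sym (ℤ.+-identityʳ (sign t))
colour-classes t (suc zero)       = sym (trans (ℤ.+-identityˡ _) (ℤ.+-identityʳ (sign t)))
colour-classes t (suc (suc zero)) = sym (trans (ℤ.+-identityˡ _) (ℤ.+-identityˡ (sign t)))

-- If T₀, T₁, T₂ differ by elements of 𝔽, every closed dual walk crosses
-- each of them equally often, so it crosses T a multiple of 3 times.
partitionable⇒tutte : ∀ {m} (G : Map m) (T : OrientedSubgraph m) → Partitionable G T → TopologicalTutte G T
partitionable⇒tutte G T (c , Tᵢ-Tⱼ∈𝔽) W closed = S.∣⇒∣ᵤ (S.divides (cross T₀ W) crossings)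
  where
    T₀ T₁ T₂ : Flow _
    T₀ = subFlow (part T c zero)
    T₁ = subFlow (part T c (suc zero))
    T₂ = subFlow (part T c (suc (suc zero)))

    T≡T₀+T₁+T₂ : ∀ e → subFlow T e ≡ T₀ e + (T₁ e + T₂ e)
    T≡T₀+T₁+T₂ e = begin
      subFlow T e
        ≡⟨ subFlow-sign T e ⟩
      sign (T e)
        ≡⟨ colour-classes (T e) (c e) ⟩
      sign (part T c zero e) + (sign (part T c (suc zero) e) + sign (part T c (suc (suc zero)) e))
        ≡⟨ sym (cong₂ _+_ (subFlow-sign (part T c zero) e)
                          (cong₂ _+_ (subFlow-sign (part T c (suc zero)) e) (subFlow-sign (part T c (suc (suc zero))) e))) ⟩
      T₀ e + (T₁ e + T₂ e) ∎
      where open ≡-Reasoning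

    same-crossing : ∀ i → cross (subFlow (part T c i)) W ≡ cross T₀ W
    same-crossing i = ℤ.i-j≡0⇒i≡j (cross (subFlow (part T c i)) W) (cross T₀ W)
      (trans (sym (cross-− (subFlow (part T c i)) T₀ W)) (𝔽⊥dual G (Tᵢ-Tⱼ∈𝔽 i zero) W closed))

    triple : ∀ x → x + (x + x) ≡ x * + 3
    triple = solve-∀

    crossings : β (subFlow T) (walkFlow W) ≡ cross T₀ W * + 3
    crossings = begin
      β (subFlow T) (walkFlow W)                ≡⟨ β-walkFlow (subFlow T) W ⟩
      cross (subFlow T) W                       ≡⟨ cross-cong W T≡T₀+T₁+T₂ ⟩
      cross (λ e → T₀ e + (T₁ e + T₂ e)) W      ≡⟨ cross-+ T₀ (λ e → T₁ e + T₂ e) W ⟩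
      cross T₀ W + cross (λ e → T₁ e + T₂ e) W  ≡⟨ cong (_+_ (cross T₀ W)) (cross-+ T₁ T₂ W) ⟩
      cross T₀ W + (cross T₁ W + cross T₂ W)    ≡⟨ cong₂ (λ x y → cross T₀ W + (x + y)) (same-crossing (suc zero)) (same-crossing (suc (suc zero))) ⟩
      cross T₀ W + (cross T₀ W + cross T₀ W)    ≡⟨ triple (cross T₀ W) ⟩
      cross T₀ W * + 3                          ∎
      where open ≡-Reasoning

module _ {P : ℕ → Set} (P? : ∀ n → Dec (P n)) where

  Least : ℕ → Set
  Least k = P k × (∀ j → j ℕ.< k → ¬ P j)

  private
    search : ∀ v → (∃ λ k → Least k) ⊎ (∀ j → j ℕ.< v → ¬ P j)
    search zero    = inj₂ (λ j ())
    search (suc v) with search v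
    ... | inj₁ least = inj₁ least
    ... | inj₂ none with P? v
    ...   | yes Pv = inj₁ (v , Pv , none)
    ...   | no ¬Pv = inj₂ below
      where
        below : ∀ j → j ℕ.< suc v → ¬ P j
        below j j<1+v with ℕₚ.m<1+n⇒m<n∨m≡n j<1+v
        ... | inj₁ j<v  = none j j<v
        ... | inj₂ refl = ¬Pv

  least-witness : ∀ {n} → P n → ∃ λ k → Least k
  least-witness {n} Pn with search (suc n)
  ... | inj₁ least = least
  ... | inj₂ none  = contradiction Pn (none n (ℕₚ.n<1+n n))

module Orbits {A : Set} (f : A → A) (f-injective : ∀ {x y} → f x ≡ f y → x ≡ y)
              {n : ℕ} (code : A → Fin n) (code-injective : ∀ {x y} → code x ≡ code y → x ≡ y) where

  open import Data.List.Extrema (Finₚ.≤-totalOrder n) using (argmin; argmin-sel; f[argmin]≤f[xs])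

  _≟ₐ_ : DecidableEquality A
  x ≟ₐ y with code x ≟ code y
  ... | yes cx≡cy = yes (code-injective cx≡cy)
  ... | no  cx≢cy = no (λ x≡y → cx≢cy (cong code x≡y))

  iter-injective : ∀ k {x y} → iter f k x ≡ iter f k y → x ≡ y
  iter-injective zero    eq = eq
  iter-injective (suc k) eq = iter-injective k (f-injective eq)

  Returns : A → ℕ → Set
  Returns x q = iter f (suc q) x ≡ x

  collision⇒return : ∀ {x i j} → i ℕ.< j → iter f i x ≡ iter f j x → ∃ λ q → q ℕ.< j × Returns x q
  collision⇒return {x} {i} {j} i<j eq = q , q<j , sym (iter-injective i (begin
      iter f i x                           ≡⟨ eq ⟩
      iter f j x                           ≡⟨ cong (λ k → iter f k x) j≡i+q ⟩
      iter f (i ℕ.+ suc q) x               ≡⟨ iter-+ f i (suc q) x ⟩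
      iter f i (iter f (suc q) x)          ∎))
    where
      open ≡-Reasoning
      q = j ℕ.∸ suc i
      j≡i+q : j ≡ i ℕ.+ suc q
      j≡i+q = sym (trans (ℕₚ.+-suc i q) (ℕₚ.m+[n∸m]≡n i<j))
      q<j : q ℕ.< j
      q<j = ℕₚ.≤-trans (ℕₚ.m≤n+m (suc q) i) (ℕₚ.≤-reflexive (sym j≡i+q))

  returns : ∀ x → ∃ (Returns x)
  returns x with Finₚ.pigeonhole (ℕₚ.n<1+n n) (λ i → code (iter f (Fin.toℕ i) x))
  ... | i , j , i<j , same-code = proj₁ return , proj₂ (proj₂ return)
    where return = collision⇒return {x} i<j (code-injective same-code)

  opaque
    first-return : ∀ x → ∃ λ p → Returns x p × (∀ q → q ℕ.< p → ¬ Returns x q)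
    first-return x = least-witness (λ q → iter f (suc q) x ≟ₐ x) {proj₁ (returns x)} (proj₂ (returns x))

  -- the orbit of x has period x + 1 elements
  period : A → ℕ
  period x = proj₁ (first-return x)

  period-returns : ∀ x → Returns x (period x)
  period-returns x = proj₁ (proj₂ (first-return x))

  period-least : ∀ x q → q ℕ.< period x → ¬ Returns x q
  period-least x = proj₂ (proj₂ (first-return x))

  orbit : A → List A
  orbit x = iterate f x (suc (period x))

  iterate-tabulate : ∀ x k → iterate f x k ≡ tabulate (λ (i : Fin k) → iter f (Fin.toℕ i) x)
  iterate-tabulate x zero    = refl
  iterate-tabulate x (suc k) =
    cong (x ∷_) (trans (iterate-tabulate (f x) k) (tabulate-cong (λ i → iter-comm f (Fin.toℕ i) x)))

  orbit-unique : ∀ x → Unique (orbit x)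
  orbit-unique x = subst Unique (sym (iterate-tabulate x (suc (period x)))) (Uniqueₚ.tabulate⁺ distinct)
    where
      contradiction-at : ∀ {B : Set} (k : Fin (suc (period x))) → ∃ (λ q → q ℕ.< Fin.toℕ k × Returns x q) → B
      contradiction-at k (q , q<k , ret) =
        contradiction ret (period-least x q (ℕₚ.<-≤-trans q<k (ℕ.s≤s⁻¹ (Finₚ.toℕ<n k))))

      distinct : ∀ {i j : Fin (suc (period x))} → iter f (Fin.toℕ i) x ≡ iter f (Fin.toℕ j) x → i ≡ j
      distinct {i} {j} eq with ℕₚ.<-cmp (Fin.toℕ i) (Fin.toℕ j)
      ... | tri≈ _ i≡j _ = Finₚ.toℕ-injective i≡j
      ... | tri< i<j _ _ = contradiction-at j (collision⇒return i<j eq)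
      ... | tri> _ _ j<i = contradiction-at i (collision⇒return j<i (sym eq))

  iter-periodic : ∀ q x → iter f (q ℕ.* suc (period x)) x ≡ x
  iter-periodic zero    x = refl
  iter-periodic (suc q) x = begin
    iter f (suc (period x) ℕ.+ q ℕ.* suc (period x)) x          ≡⟨ iter-+ f (suc (period x)) _ x ⟩
    iter f (suc (period x)) (iter f (q ℕ.* suc (period x)) x)   ≡⟨ cong (iter f (suc (period x))) (iter-periodic q x) ⟩
    iter f (suc (period x)) x                                   ≡⟨ period-returns x ⟩
    x                                                           ∎
    where open ≡-Reasoning

  ∈-orbit⁻ : ∀ {x y} → y ∈ orbit x → Reaches f x y
  ∈-orbit⁻ {x} {y} y∈orbit
    with ∈ₚ.∈-tabulate⁻ {f = λ i → iter f (Fin.toℕ i) x} (subst (y ∈_) (iterate-tabulate x (suc (period x))) y∈orbit)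
  ... | i , y≡ = Fin.toℕ i , sym y≡

  ∈-orbit⁺ : ∀ {x y} → Reaches f x y → y ∈ orbit x
  ∈-orbit⁺ {x} (k , refl) = subst (_∈ orbit x) reduce
    (subst (iter f (Fin.toℕ i) x ∈_) (sym (iterate-tabulate x P)) (∈ₚ.∈-tabulate⁺ {f = λ i → iter f (Fin.toℕ i) x} i))
    where
      open ≡-Reasoning
      P = suc (period x)
      i : Fin P
      i = Fin.fromℕ< (DivMod.m%n<n k P)
      reduce : iter f (Fin.toℕ i) x ≡ iter f k x
      reduce = begin
        iter f (Fin.toℕ i) x                                ≡⟨ cong (λ j → iter f j x) (Finₚ.toℕ-fromℕ< (DivMod.m%n<n k P)) ⟩
        iter f (k ℕ.% P) x                                  ≡⟨ cong (iter f (k ℕ.% P)) (sym (iter-periodic (k ℕ./ P) x)) ⟩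
        iter f (k ℕ.% P) (iter f ((k ℕ./ P) ℕ.* P) x)       ≡⟨ sym (iter-+ f (k ℕ.% P) _ x) ⟩
        iter f (k ℕ.% P ℕ.+ (k ℕ./ P) ℕ.* P) x              ≡⟨ cong (λ j → iter f j x) (sym (DivMod.m≡m%n+[m/n]*n k P)) ⟩
        iter f k x                                          ∎

  reaches-sym : ∀ {x y} → Reaches f x y → Reaches f y x
  reaches-sym {x} (k , refl) = k ℕ.* P ℕ.∸ k , (begin
    iter f (k ℕ.* P ℕ.∸ k) (iter f k x)  ≡⟨ sym (iter-+ f (k ℕ.* P ℕ.∸ k) k x) ⟩
    iter f (k ℕ.* P ℕ.∸ k ℕ.+ k) x       ≡⟨ cong (λ j → iter f j x) (ℕₚ.m∸n+n≡m (ℕₚ.m≤m*n k P)) ⟩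
    iter f (k ℕ.* P) x                   ≡⟨ iter-periodic k x ⟩
    x                                    ∎)
    where
      open ≡-Reasoning
      P = suc (period x)

  opaque
    rep : A → A
    rep x = argmin code x (orbit x)

    rep-∈ : ∀ x → rep x ∈ orbit x
    rep-∈ x with argmin-sel code x (orbit x)
    ... | inj₁ rep≡x = subst (_∈ orbit x) (sym rep≡x) (here refl)
    ... | inj₂ rep∈  = rep∈

    rep-least : ∀ {x y} → y ∈ orbit x → code (rep x) Fin.≤ code y
    rep-least {x} = All.lookup (f[argmin]≤f[xs] {f = code} x (orbit x))

  rep-cong : ∀ {x y} → Reaches f x y → rep x ≡ rep y
  rep-cong {x} {y} x→y = code-injective (Finₚ.≤-antisym
    (rep-least (∈-orbit⁺ (reaches-trans x→y (∈-orbit⁻ (rep-∈ y)))))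
    (rep-least (∈-orbit⁺ (reaches-trans (reaches-sym x→y) (∈-orbit⁻ (rep-∈ x))))))

dartTag : ∀ {m} → Dart m → Fin m ⊎ Fin m
dartTag (e , true)  = inj₁ e
dartTag (e , false) = inj₂ e

dartTag-injective : ∀ {m} {x y : Dart m} → dartTag x ≡ dartTag y → x ≡ y
dartTag-injective {x = e , true}  {e′ , true}  refl = refl
dartTag-injective {x = e , false} {e′ , false} refl = refl
dartTag-injective {x = e , true}  {e′ , false} ()
dartTag-injective {x = e , false} {e′ , true}  ()

dartCode : ∀ {m} → Dart m → Fin (m ℕ.+ m)
dartCode {m} d = Fin.join m m (dartTag d)

dartCode-injective : ∀ {m} {x y : Dart m} → dartCode x ≡ dartCode y → x ≡ y
dartCode-injective {m} {x} {y} eq = dartTag-injective (begin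
  dartTag x                          ≡⟨ sym (Finₚ.splitAt-join m m (dartTag x)) ⟩
  Fin.splitAt m (dartCode x)         ≡⟨ cong (Fin.splitAt m) eq ⟩
  Fin.splitAt m (dartCode y)         ≡⟨ Finₚ.splitAt-join m m (dartTag y) ⟩
  dartTag y                          ∎)
  where open ≡-Reasoning

-- Every face coboundary lies in 𝔽.  The faces of G are the orbits of φ, and
-- each orbit, listed once, is a facial walk.

module Faces {m : ℕ} (G : Map m) where
  open Orbits (φ G) (φ-injective G) dartCode dartCode-injective
  open import Data.List.Membership.DecPropositional (_≟ᵈ_ {m}) using (_∈?_)

  orbit-facial : ∀ d → IsFacialWalk G (orbit d)
  orbit-facial d = chain d (suc (period d)) , closes d (period d) (period-returns d) , orbit-unique d
    where
      chain : ∀ x k → φChain G (iterate (φ G) x k)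
      chain x zero          = tt
      chain x (suc zero)    = tt
      chain x (suc (suc k)) = refl , chain (φ G x) (suc k)

      closes : ∀ x k → iter (φ G) (suc k) x ≡ d → lastφTo G d (iterate (φ G) x (suc k))
      closes x zero    φx≡d = φx≡d
      closes x (suc k) ret  = closes (φ G x) k (trans (iter-comm (φ G) (suc k) x) ret)

  module _ (H : Dart m → ℤ) (H-face : FaceInvariant G H) where

    weight : Dart m → ℤ
    weight d = if does (rep d ≟ᵈ d) then H d else + 0

    weight-rep : ∀ d → rep d ≡ d → weight d ≡ H d
    weight-rep d rep≡d with rep d ≟ᵈ d
    ... | yes _    = refl
    ... | no rep≢d = contradiction rep≡d rep≢d

    -- The face of y is counted exactly once: at its representative.
    weight-occ : ∀ y d → weight d * occ y (orbit d) ≡ (if does (rep y ≟ᵈ d) then H y else + 0)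
    weight-occ y d with rep y ≟ᵈ d
    ... | yes refl = begin
      weight (rep y) * occ y (orbit (rep y)) ≡⟨ cong₂ _*_ (weight-rep (rep y) (sym (rep-cong rep-reached)))
                                                          (occ-∈ (orbit-unique (rep y)) (∈-orbit⁺ reaches-y)) ⟩
      H (rep y) * + 1                        ≡⟨ ℤ.*-identityʳ (H (rep y)) ⟩
      H (rep y)                              ≡⟨ sameFace-invariant G H-face reaches-y ⟩
      H y                                    ∎
      where
        open ≡-Reasoning
        rep-reached : SameFace G y (rep y)
        rep-reached = ∈-orbit⁻ (rep-∈ y)
        reaches-y : SameFace G (rep y) y
        reaches-y = reaches-sym rep-reached
    ... | no rep-y≢d with rep d ≟ᵈ d
    ...   | no _       = ℤ.*-zeroˡ (occ y (orbit d))
    ...   | yes rep-d≡d with y ∈? orbit d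
    ...     | yes y∈ = contradiction (trans (sym (rep-cong (∈-orbit⁻ y∈))) rep-d≡d) rep-y≢d
    ...     | no y∉  = trans (cong (H d *_) (occ-∉ y∉)) (ℤ.*-zeroʳ (H d))

    face-count : ∀ y → ΣDart (λ d → weight d * occ y (orbit d)) ≡ H y
    face-count y = trans (ΣDart-cong (weight-occ y)) (ΣDart-delta (rep y) (λ _ → H y))

    coboundary∈𝔽 : In𝔽 G (λ e → H (e , true) - H (e , false))
    coboundary∈𝔽 = In𝔽-cong G coboundary (In𝔽-sumFin G _ (λ e → In𝔽-+ G (face (e , true)) (face (e , false))))
      where
        face : ∀ d → In𝔽 G (λ e → weight d * walkFlow (orbit d) e)
        face d = In𝔽-facial G (weight d) (orbit-facial d)

        distribute : ∀ k a b → k * (a - b) ≡ k * a - k * b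
        distribute = solve-∀

        per-dart : ∀ e d → weight d * walkFlow (orbit d) e
                         ≡ weight d * occ (e , true) (orbit d) - weight d * occ (e , false) (orbit d)
        per-dart e d = begin
          weight d * walkFlow (orbit d) e
            ≡⟨ cong (weight d *_) (sym (ℤ.*-identityʳ (walkFlow (orbit d) e))) ⟩
          weight d * (walkFlow (orbit d) e * + 1)
            ≡⟨ cong (weight d *_) (walkFlow-occ (orbit d) e true) ⟩
          weight d * (occ (e , true) (orbit d) - occ (e , false) (orbit d))
            ≡⟨ distribute (weight d) (occ (e , true) (orbit d)) (occ (e , false) (orbit d)) ⟩
          weight d * occ (e , true) (orbit d) - weight d * occ (e , false) (orbit d) ∎
          where open ≡-Reasoning

        coboundary : ∀ e → H (e , true) - H (e , false) ≡ ΣDart (λ d → weight d * walkFlow (orbit d) e)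
        coboundary e = sym (begin
          ΣDart (λ d → weight d * walkFlow (orbit d) e)
            ≡⟨ ΣDart-cong (per-dart e) ⟩
          ΣDart (λ d → weight d * occ (e , true) (orbit d) - weight d * occ (e , false) (orbit d))
            ≡⟨ ΣDart-− (λ d → weight d * occ (e , true) (orbit d)) (λ d → weight d * occ (e , false) (orbit d)) ⟩
          ΣDart (λ d → weight d * occ (e , true) (orbit d)) - ΣDart (λ d → weight d * occ (e , false) (orbit d))
            ≡⟨ cong₂ _-_ (face-count (e , true)) (face-count (e , false)) ⟩
          H (e , true) - H (e , false) ∎)
          where open ≡-Reasoning

infix 4 _≡₃_
_≡₃_ : ℤ → ℤ → Set
x ≡₃ y = + 3 S.∣ (x - y)

≡₃-reflexive : ∀ {x y} → x ≡ y → x ≡₃ y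
≡₃-reflexive {x} refl = S.divides (+ 0) (ℤ.+-inverseʳ x)

≡₃-sym : ∀ {x y} → x ≡₃ y → y ≡₃ x
≡₃-sym {x} {y} 3∣x-y = subst (+ 3 S.∣_) (negate x y) (S.∣m⇒∣-m 3∣x-y)
  where
    negate : ∀ x y → - (x - y) ≡ y - x
    negate = solve-∀

≡₃-trans : ∀ {x y z} → x ≡₃ y → y ≡₃ z → x ≡₃ z
≡₃-trans {x} {y} {z} 3∣x-y 3∣y-z = subst (+ 3 S.∣_) (chain x y z) (S.∣m∣n⇒∣m+n 3∣x-y 3∣y-z)
  where
    chain : ∀ x y z → (x - y) + (y - z) ≡ x - z
    chain = solve-∀

≡₃-+ : ∀ {x y u v} → x ≡₃ y → u ≡₃ v → x + u ≡₃ y + v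
≡₃-+ {x} {y} {u} {v} 3∣x-y 3∣u-v = subst (+ 3 S.∣_) (+-−-interchange x y u v) (S.∣m∣n⇒∣m+n 3∣x-y 3∣u-v)

toℤ : Fin 3 → ℤ
toℤ r = + Fin.toℕ r

residue : ℤ → Fin 3
residue x = Fin.fromℕ< (n%ℕd<d x 3)

residue-≡₃ : ∀ x → x ≡₃ toℤ (residue x)
residue-≡₃ x = S.divides (x /ℕ 3) (begin
  x - toℤ (residue x)                        ≡⟨ cong₂ _-_ (a≡a%ℕn+[a/ℕn]*n x 3) (cong +_ (Finₚ.toℕ-fromℕ< (n%ℕd<d x 3))) ⟩
  (+ (x %ℕ 3) + (x /ℕ 3) * + 3) - + (x %ℕ 3) ≡⟨ cancel (+ (x %ℕ 3)) (x /ℕ 3) ⟩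
  (x /ℕ 3) * + 3                             ∎)
  where
    open ≡-Reasoning
    cancel : ∀ r q → (r + q * + 3) - r ≡ q * + 3
    cancel = solve-∀

residue-injective : ∀ {r s} → toℤ r ≡₃ toℤ s → r ≡ s
residue-injective {r} {s} r≡₃s with r Fin.≟ s
... | yes r≡s = r≡s
... | no  r≢s = contradiction r≡₃s (incongruent r s r≢s)
  where
    incongruent : ∀ r s → r ≢ s → ¬ (toℤ r ≡₃ toℤ s)
    incongruent zero             zero             r≢s = contradiction refl r≢s
    incongruent (suc zero)       (suc zero)       r≢s = contradiction refl r≢s
    incongruent (suc (suc zero)) (suc (suc zero)) r≢s = contradiction refl r≢s
    incongruent zero             (suc zero)       _   = toWitnessFalse {a? = + 3 S.∣? (+ 0 - + 1)} tt
    incongruent zero             (suc (suc zero)) _   = toWitnessFalse {a? = + 3 S.∣? (+ 0 - + 2)} tt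
    incongruent (suc zero)       zero             _   = toWitnessFalse {a? = + 3 S.∣? (+ 1 - + 0)} tt
    incongruent (suc zero)       (suc (suc zero)) _   = toWitnessFalse {a? = + 3 S.∣? (+ 1 - + 2)} tt
    incongruent (suc (suc zero)) zero             _   = toWitnessFalse {a? = + 3 S.∣? (+ 2 - + 0)} tt
    incongruent (suc (suc zero)) (suc zero)       _   = toWitnessFalse {a? = + 3 S.∣? (+ 2 - + 1)} tt

residue-cong : ∀ {x y} → x ≡₃ y → residue x ≡ residue y
residue-cong {x} {y} x≡₃y = residue-injective
  (≡₃-trans {toℤ (residue x)} {x} (≡₃-sym {x} (residue-≡₃ x)) (≡₃-trans {x} {y} x≡₃y (residue-≡₃ y)))

module _ {m : ℕ} (G : Map m) where

  DualPath : Dart m → Dart m → List (Dart m) → Set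
  DualPath a b []      = SameFace G a b
  DualPath a b (δ ∷ W) = SameFace G a (rev δ) × DualPath δ b W

  dualPath-start : ∀ {a a′ b} W → SameFace G a a′ → DualPath a′ b W → DualPath a b W
  dualPath-start []      a~a′ a′~b        = reaches-trans a~a′ a′~b
  dualPath-start (δ ∷ W) a~a′ (a′~δ , path) = reaches-trans a~a′ a′~δ , path

  dualPath-++ : ∀ {a b c} W W′ → DualPath a b W → DualPath b c W′ → DualPath a c (W ++ W′)
  dualPath-++ []      W′ a~b          path′ = dualPath-start W′ a~b path′
  dualPath-++ (δ ∷ W) W′ (a~δ , path) path′ = a~δ , dualPath-++ W W′ path path′

  dualPath-closed : ∀ {a} W → DualPath a a W → IsDualClosedWalk G W
  dualPath-closed []      _             = tt
  dualPath-closed (δ ∷ W) (a~δ , path) = ends δ W a~δ path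
    where
      ends : ∀ {a b} δ W → SameFace G b (rev a) → DualPath δ b W → DualConsecutive G (δ ∷ W) × dualLastTo G a (δ ∷ W)
      ends δ []       b~a δ~b          = tt , reaches-trans δ~b b~a
      ends δ (δ′ ∷ W) b~a (δ~δ′ , path) with ends δ′ W b~a path
      ... | consecutive , last = (δ~δ′ , consecutive) , last

  connected-dualPath : ∀ {a b} → Reach G a b → ∃ (DualPath a b)
  connected-dualPath here = [] , (0 , refl)
  connected-dualPath {a} (viaσ reach) with connected-dualPath reach
  ... | W , path = rev a ∷ W , (0 , sym (rev-involutive a)) , dualPath-start W (1 , cong (Map.σ G) (rev-involutive a)) path
  connected-dualPath {a} (viarev reach) with connected-dualPath reach
  ... | W , path = rev a ∷ W , (0 , sym (rev-involutive a)) , path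

shift : Maybe Bool → Fin 3 → Fin 3
shift t r = residue (toℤ r + sign t)

-- ρ labels faces by residues mod 3, and T is its coboundary: crossing an
-- edge e from its right face to its left face adds sign (T e).
Potential : ∀ {m} → Map m → OrientedSubgraph m → (Dart m → Fin 3) → Set
Potential {m} G T ρ = FaceInvariant G ρ × (∀ e → ρ (e , true) ≡ shift (T e) (ρ (e , false)))

-- Fix a base dart; the potential of a face is the crossing number of T
-- along some dual path from the base face, which the Tutte condition makes
-- well defined mod 3.
module TuttePotential {m : ℕ} (G : Map m) (connected : Connected G) (T : OrientedSubgraph m)
                      (tutte : TopologicalTutte G T) (base : Dart m) where

  τ : Flow m
  τ = subFlow T

  closed-crossing : ∀ W → IsDualClosedWalk G W → + 3 S.∣ cross τ W
  closed-crossing W closed = subst (+ 3 S.∣_) (β-walkFlow τ W) (S.∣ᵤ⇒∣ (tutte W closed))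

  to from : Dart m → List (Dart m)
  to   a = proj₁ (connected-dualPath G (connected base a))
  from a = proj₁ (connected-dualPath G (connected a base))

  to-path : ∀ a → DualPath G base a (to a)
  to-path a = proj₂ (connected-dualPath G (connected base a))

  from-path : ∀ a → DualPath G a base (from a)
  from-path a = proj₂ (connected-dualPath G (connected a base))

  P : Dart m → ℤ
  P a = cross τ (to a)

  loop-crossing : ∀ {c} W W′ → DualPath G base c W → DualPath G c base W′ → + 3 S.∣ cross τ W + cross τ W′
  loop-crossing W W′ out back = subst (+ 3 S.∣_) (cross-++ τ W W′)
    (closed-crossing (W ++ W′) (dualPath-closed G (W ++ W′) (dualPath-++ G W W′ out back)))

  potential-step : ∀ {a b} W → DualPath G a b W → P b ≡₃ P a + cross τ W
  potential-step {a} {b} W path = subst (+ 3 S.∣_) (rearrange (P a) (P b) (cross τ W) (Q b))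
      (S.∣m∣n⇒∣m-n (loop-crossing (to b) (from b) (to-path b) (from-path b)) via-W)
    where
      Q : Dart m → ℤ
      Q c = cross τ (from c)

      via-W : + 3 S.∣ P a + (cross τ W + Q b)
      via-W = subst (λ z → + 3 S.∣ P a + z) (cross-++ τ W (from b))
        (loop-crossing (to a) (W ++ from b) (to-path a) (dualPath-++ G W (from b) path (from-path b)))

      rearrange : ∀ pa pb w qb → (pb + qb) - (pa + (w + qb)) ≡ pb - (pa + w)
      rearrange = solve-∀

  ρ : Dart m → Fin 3
  ρ a = residue (P a)

  ρ-potential : Potential G T ρ
  ρ-potential = face-invariant , across-edge
    where
      face-invariant : FaceInvariant G ρ
      face-invariant d = residue-cong {P (φ G d)} {P d}
        (subst (P (φ G d) ≡₃_) (ℤ.+-identityʳ (P d)) (potential-step {d} [] (1 , refl)))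

      across-edge : ∀ e → ρ (e , true) ≡ shift (T e) (ρ (e , false))
      across-edge e = residue-cong {P (e , true)} (≡₃-trans {P (e , true)} step
        (≡₃-+ {P (e , false)} (residue-≡₃ (P (e , false))) (≡₃-reflexive {cross τ [ (e , true) ]} crossing-e)))
        where
          step : P (e , true) ≡₃ P (e , false) + cross τ [ (e , true) ]
          step = potential-step [ (e , true) ] ((0 , refl) , (0 , refl))

          crossing-e : cross τ [ (e , true) ] ≡ sign (T e)
          crossing-e = trans (ℤ.+-identityʳ (τ e * + 1)) (trans (ℤ.*-identityʳ (τ e)) (subFlow-sign T e))

tutte⇒potential : ∀ {m} (G : Map m) → Connected G → (T : OrientedSubgraph m) →
                  TopologicalTutte G T → ∃ (Potential G T)
tutte⇒potential {zero}  G connected T tutte = (λ ()) , (λ ()) , (λ ())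
tutte⇒potential {suc m} G connected T tutte = ρ , ρ-potential
  where open TuttePotential G connected T tutte (zero , true)

-- An edge oriented t whose right face has potential r gets the colour of
-- the lower of its two face potentials (in the cyclic order of ℤ₃).
colour : Maybe Bool → Fin 3 → Fin 3
colour (just true)  r = r
colour (just false) r = shift (just false) r
colour nothing      r = zero

colourClass : Maybe Bool → Fin 3 → Fin 3 → Maybe Bool
colourClass t r i = if does (colour t r ≟ i) then t else nothing

level : Fin 3 → Fin 3 → ℤ
level i x = if (1 ℕ.≤ᵇ Fin.toℕ x) Bool.∧ (Fin.toℕ x ℕ.≤ᵇ Fin.toℕ i) then + 1 else + 0

ColourCoboundary : Maybe Bool → Fin 3 → Fin 3 → Set
ColourCoboundary t r i = sign (colourClass t r i) ≡ sign (colourClass t r zero) - (level i (shift t r) - level i r)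

colour-coboundary? : ∀ t → Dec (∀ r i → ColourCoboundary t r i)
colour-coboundary? t = Finₚ.all? λ r → Finₚ.all? λ i →
  sign (colourClass t r i) ℤ.≟ sign (colourClass t r zero) - (level i (shift t r) - level i r)

colour-coboundary : ∀ t r i → ColourCoboundary t r i
colour-coboundary nothing      = toWitness {a? = colour-coboundary? nothing} tt
colour-coboundary (just true)  = toWitness {a? = colour-coboundary? (just true)} tt
colour-coboundary (just false) = toWitness {a? = colour-coboundary? (just false)} tt

potential⇒partitionable : ∀ {m} (G : Map m) (T : OrientedSubgraph m) → ∃ (Potential G T) → Partitionable G T
potential⇒partitionable G T (ρ , ρ-face , ρ-edge) = c , classes-differ
  where
    c : Fin _ → Fin 3
    c e = colour (T e) (ρ (e , false))

    classes-differ : ∀ i j → In𝔽 G (λ e → subFlow (part T c i) e - subFlow (part T c j) e)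
    classes-differ i j = In𝔽-cong G edgewise (Faces.coboundary∈𝔽 G H H-face)
      where
        H : Dart _ → ℤ
        H d = level j (ρ d) - level i (ρ d)

        H-face : FaceInvariant G H
        H-face d = cong (λ r → level j r - level i r) (ρ-face d)

        regroup : ∀ c₀ aᵢ rᵢ aⱼ rⱼ → (c₀ - (aᵢ - rᵢ)) - (c₀ - (aⱼ - rⱼ)) ≡ (aⱼ - aᵢ) - (rⱼ - rᵢ)
        regroup = solve-∀

        edgewise : ∀ e → subFlow (part T c i) e - subFlow (part T c j) e ≡ H (e , true) - H (e , false)
        edgewise e = begin
          subFlow (part T c i) e - subFlow (part T c j) e
            ≡⟨ cong₂ _-_ (subFlow-sign (part T c i) e) (subFlow-sign (part T c j) e) ⟩
          sign (colourClass t r i) - sign (colourClass t r j)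
            ≡⟨ cong₂ _-_ (colour-coboundary t r i) (colour-coboundary t r j) ⟩
          (sign (colourClass t r zero) - (level i (shift t r) - level i r))
            - (sign (colourClass t r zero) - (level j (shift t r) - level j r))
            ≡⟨ regroup (sign (colourClass t r zero)) (level i (shift t r)) (level i r) (level j (shift t r)) (level j r) ⟩
          (level j (shift t r) - level i (shift t r)) - (level j r - level i r)
            ≡⟨ cong (λ a → (level j a - level i a) - (level j r - level i r)) (sym (ρ-edge e)) ⟩
          H (e , true) - H (e , false) ∎
          where
            open ≡-Reasoning
            t = T e
            r = ρ (e , false)

lemma25 : ∀ {m : ℕ} (G : Map m) → Connected G → NoShortContractibleCycles G →
    (T : OrientedSubgraph m) → Partitionable G T ⇔ TopologicalTutte G T
lemma25 G connected _ T = mk⇔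
  (partitionable⇒tutte G T)
  (λ tutte → potential⇒partitionable G T (tutte⇒potential G connected T tutte))
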